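{- Let $k$ be a positive integer, let $d\ge 1$ be an integer, and let $G$ be a graph such that $G$ has a connected vertex cover of size at most $k$ (i.e. $OPT(G,k)\le k$), and such that $(G,k)$ is irreducible with respect to the following two rules: (1) there is no vertex $v\in I$ of degree at least $d$, and (2) no vertex of $G$ has at least $k+1$ false twins. Then $|V(G)|=O(k^{d}+k^2)$.
   Context: Here $d=\lceil \frac{\alpha}{\alpha-1}\rceil$ for a fixed $\alpha>1$. A connected vertex cover of $G$ is a set $S\subseteq V(G)$ such that every edge has an endpoint in $S$ and $G[S]$ is connected. $H$ denotes the set of vertices of $G$ of degree at least $k+1$, and $I=\{v\in V(G)\setminus H : N_G(v)\subseteq H\}$. A false twin of a vertex $v$ is a vertex $u$ with $uv\notin E(G)$ and $N(u)=N(v)$. -}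

module Defs where

open import Data.Nat using (ℕ; suc; _≤_; _<_)
open import Data.Bool using (Bool; true; false)
open import Data.Fin using (Fin)
open import Data.Fin.Subset using (Subset; _∈_; _∉_; ∣_∣)
open import Data.Vec using (tabulate)
open import Data.Product using (Σ; _×_)
open import Data.Sum using (_⊎_)
open import Relation.Binary.PropositionalEquality using (_≡_)
open import Relation.Nullary using (¬_)

record Graph : Set where
  field
    n      : ℕ
    adj    : Fin n → Fin n → Bool
    sym    : ∀ u v → adj u v ≡ adj v u
    irrefl : ∀ v → adj v v ≡ false

module _ (G : Graph) where
  open Graph G

  Edge : Fin n → Fin n → Set
  Edge u v = adj u v ≡ true

  N : Fin n → Subset n
  N v = tabulate (adj v)

  deg : Fin n → ℕ
  deg v = ∣ N v ∣

  data WalkIn (S : Subset n) : Fin n → Fin n → Set where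
    [] : ∀ {u} → WalkIn S u u
    _∷_ : ∀ {u w v} → (Edge u w × w ∈ S) → WalkIn S w v → WalkIn S u v

  IsVertexCover : Subset n → Set
  IsVertexCover S = ∀ u v → Edge u v → u ∈ S ⊎ v ∈ S

  InducedConnected : Subset n → Set
  InducedConnected S = ∀ u v → u ∈ S → v ∈ S → WalkIn S u v

  IsConnectedVertexCover : Subset n → Set
  IsConnectedVertexCover S = IsVertexCover S × InducedConnected S

  HasCVCOfSize≤ : ℕ → Set
  HasCVCOfSize≤ k = Σ (Subset n) λ S → IsConnectedVertexCover S × ∣ S ∣ ≤ k

  InH : ℕ → Fin n → Set
  InH k v = suc k ≤ deg v

  InI : ℕ → Fin n → Set
  InI k v = ¬ InH k v × (∀ w → Edge v w → InH k w)

  FalseTwin : Fin n → Fin n → Set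
  FalseTwin v u = ¬ (u ≡ v) × ¬ Edge u v × (∀ w → adj u w ≡ adj v w)

  Rule1Irreducible : ℕ → ℕ → Set
  Rule1Irreducible k d = ∀ v → InI k v → deg v < d

  Rule2Irreducible : ℕ → Set
  Rule2Irreducible k = ∀ v (T : Subset n) → (∀ u → u ∈ T → FalseTwin v u) → ∣ T ∣ ≤ k

-- Let S be a connected vertex cover with |S| ≤ k. A vertex outside S has all its
-- neighbours in S, hence degree at most k. Those with a neighbour of degree ≤ k
-- hang off at most k vertices of degree ≤ k, so there are at most k² of them. The
-- others lie in I, so by Rule 1 they have at most d - 1 neighbours, all in S; there
-- are at most (k + 1)^(d - 1) such neighbourhoods, and by Rule 2 at most k + 1
-- vertices share one. Altogether |V(G)| ≤ k + k² + (k + 1)^d.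
module Submission where

open import Defs
open import Data.Nat using (ℕ; zero; suc; _≤_; _+_; _*_; _^_; _≤?_; z≤n; s≤s; >-nonZero)
open import Data.Nat.Properties hiding (_≟_)
open import Data.Nat.Tactic.RingSolver using (solve-∀)
open import Data.Bool using (Bool; true; false; _∧_; not)
open import Data.Bool.Properties using (¬-not) renaming (_≟_ to _≟ᵇ_)
open import Data.Empty using (⊥-elim)
open import Data.Fin using (Fin; zero; suc)
open import Data.Fin.Properties using (any?; _≟_)
open import Data.Fin.Subset using (Subset; _∈_; ∣_∣)
open import Data.Fin.Subset.Properties using (p⊆q⇒∣p∣≤∣q∣)
open import Data.Product using (Σ; ∃; _×_; _,_; proj₁; proj₂)
open import Data.Sum using (inj₁; inj₂)
open import Data.Vec using (tabulate; lookup)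
open import Data.Vec.Properties using (lookup∘tabulate; tabulate∘lookup; tabulate-cong; []=⇒lookup; lookup⇒[]=)
open import Function using (_∘_; id; case_of_)
open import Relation.Binary.PropositionalEquality
open import Relation.Nullary using (¬_; Dec; yes; no; does; _×-dec_)
open import Relation.Nullary.Decidable using (dec-true)

true≢false : true ≢ false
true≢false ()

∧-true⁻ : ∀ {x y} → x ∧ y ≡ true → x ≡ true × y ≡ true
∧-true⁻ {true} {true} _ = refl , refl

not-true⁻ : ∀ {x} → not x ≡ true → x ≡ false
not-true⁻ {false} _ = refl

does-true⁻ : ∀ {ℓ} {A : Set ℓ} (a? : Dec A) → does a? ≡ true → A
does-true⁻ (yes a) _ = a

does-false⁻ : ∀ {ℓ} {A : Set ℓ} (a? : Dec A) → does a? ≡ false → ¬ A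
does-false⁻ (no ¬a) _ = ¬a

module _ {m : ℕ} where

  _⊆ᵇ_ : (Fin m → Bool) → (Fin m → Bool) → Set
  p ⊆ᵇ q = ∀ i → p i ≡ true → q i ≡ true

  count : (Fin m → Bool) → ℕ
  count p = ∣ tabulate p ∣

  ∈-tabulate⁻ : ∀ {p : Fin m → Bool} {i} → i ∈ tabulate p → p i ≡ true
  ∈-tabulate⁻ {p} {i} i∈ = trans (sym (lookup∘tabulate p i)) ([]=⇒lookup i∈)

  ∈-tabulate⁺ : ∀ {p : Fin m → Bool} {i} → p i ≡ true → i ∈ tabulate p
  ∈-tabulate⁺ {p} {i} pi = lookup⇒[]= i (tabulate p) (trans (lookup∘tabulate p i) pi)

  count-cong : ∀ (p q : Fin m → Bool) → (∀ i → p i ≡ q i) → count p ≡ count q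
  count-cong _ _ p≗q = cong ∣_∣ (tabulate-cong p≗q)

  count-mono : ∀ (p q : Fin m → Bool) → p ⊆ᵇ q → count p ≤ count q
  count-mono _ _ p⊆q = p⊆q⇒∣p∣≤∣q∣ λ {i} i∈p → ∈-tabulate⁺ (p⊆q i (∈-tabulate⁻ i∈p))

  count-lookup : (S : Subset m) → count (lookup S) ≡ ∣ S ∣
  count-lookup S = cong ∣_∣ (tabulate∘lookup S)

count-none : ∀ {m} (p : Fin m → Bool) → ¬ (∃ λ i → p i ≡ true) → count p ≡ 0
count-none {zero} _ _ = refl
count-none {suc m} p none with p zero in p₀
... | true  = ⊥-elim (none (zero , p₀))
... | false = count-none (p ∘ suc) λ (i , pi) → none (suc i , pi)

count-all : ∀ m → count {m} (λ _ → true) ≡ m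
count-all zero    = refl
count-all (suc m) = cong suc (count-all m)

count-split : ∀ {m} (p q : Fin m → Bool) →
  count p ≡ count (λ i → p i ∧ q i) + count (λ i → p i ∧ not (q i))
count-split {zero} p q = refl
count-split {suc m} p q with p zero | q zero | count-split (p ∘ suc) (q ∘ suc)
... | false | _     | ih = ih
... | true  | true  | ih = cong suc ih
... | true  | false | ih = trans (cong suc ih) (sym (+-suc _ _))

count-head-true : ∀ {m} (p : Fin (suc m) → Bool) → p zero ≡ true → count p ≡ suc (count (p ∘ suc))
count-head-true p p₀ rewrite p₀ = refl

count-tail-≤ : ∀ {m} (p : Fin (suc m) → Bool) → count (p ∘ suc) ≤ count p
count-tail-≤ p with p zero
... | true  = n≤1+n _
... | false = ≤-refl

count-≟ : ∀ {m} (v : Fin m) → count (λ u → does (u ≟ v)) ≡ 1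
count-≟ {suc m} zero    = cong suc (count-none {m} (λ u → does (suc u ≟ zero)) λ { (_ , ()) })
count-≟ {suc m} (suc v) = count-≟ v

∃-suc : ∀ {a ℓ} {P : Fin (suc a) → Set ℓ} → ¬ P zero → ∃ P → ∃ (P ∘ suc)
∃-suc ¬P₀ (zero  , P₀) = ⊥-elim (¬P₀ P₀)
∃-suc _   (suc i , Pi) = i , Pi

count-≤-* : ∀ {m a} (P : Fin m → Bool) (Q : Fin a → Bool) (R : Fin m → Fin a → Bool) (c : ℕ) →
  (∀ v → P v ≡ true → ∃ λ w → Q w ≡ true × R v w ≡ true) →
  (∀ w → Q w ≡ true → count (λ v → R v w) ≤ c) →
  count P ≤ count Q * c
count-≤-* {a = zero} P Q R c covered _ = ≤-reflexive (count-none P λ (v , Pv) → case covered v Pv of λ { (() , _) })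
count-≤-* {a = suc a} P Q R c covered fibre with Q zero in Q₀
... | false = count-≤-* P (Q ∘ suc) (λ v → R v ∘ suc) c
                (λ v Pv → ∃-suc (λ (Q₀′ , _) → true≢false (trans (sym Q₀′) Q₀)) (covered v Pv))
                (fibre ∘ suc)
... | true = begin
  count P                                                     ≡⟨ count-split P (λ v → R v zero) ⟩
  count (λ v → P v ∧ R v zero) + count (λ v → P v ∧ not (R v zero))
    ≤⟨ +-mono-≤ (≤-trans (count-mono _ (λ v → R v zero) λ v → proj₂ ∘ ∧-true⁻) (fibre zero Q₀)) rest ⟩
  c + count (Q ∘ suc) * c                                     ∎
  where
  open ≤-Reasoning
  rest : count (λ v → P v ∧ not (R v zero)) ≤ count (Q ∘ suc) * c
  rest = count-≤-* _ (Q ∘ suc) (λ v → R v ∘ suc) c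
    (λ v e → let (Pv , ¬R₀) = ∧-true⁻ e in
      ∃-suc (λ (_ , R₀) → true≢false (trans (sym R₀) (not-true⁻ ¬R₀))) (covered v Pv))
    (fibre ∘ suc)

SameRows : ∀ {m a} → (Fin m → Fin a → Bool) → (Fin m → Bool) → Set
SameRows row Q = ∀ u v → Q u ≡ true → Q v ≡ true → ∀ i → row u i ≡ row v i

sameRows-tail : ∀ {m a} (row : Fin m → Fin (suc a) → Bool) (P P′ : Fin m → Bool) (b : ℕ) (x : Bool) →
  (∀ Q → Q ⊆ᵇ P → SameRows row Q → count Q ≤ b) →
  P′ ⊆ᵇ P → (∀ v → P′ v ≡ true → row v zero ≡ x) →
  ∀ Q → Q ⊆ᵇ P′ → SameRows (λ v → row v ∘ suc) Q → count Q ≤ b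
sameRows-tail row P P′ b x classes P′⊆P column₀ Q Q⊆P′ sameTail = classes Q Q⊆P same
  where
  Q⊆P : Q ⊆ᵇ P
  Q⊆P v = P′⊆P v ∘ Q⊆P′ v
  same : SameRows row Q
  same u v Qu Qv zero    = trans (column₀ u (Q⊆P′ u Qu)) (sym (column₀ v (Q⊆P′ v Qv)))
  same u v Qu Qv (suc i) = sameTail u v Qu Qv i

sum-of-powers-≤ : ∀ b X j → b * X ^ j + b * X ^ suc j ≤ b * suc X ^ suc j
sum-of-powers-≤ b X j = begin
  b * X ^ j + b * (X * X ^ j) ≡⟨ factor b X (X ^ j) ⟩
  b * (suc X * X ^ j)         ≤⟨ *-monoʳ-≤ b (*-monoʳ-≤ (suc X) (^-monoˡ-≤ j (n≤1+n X))) ⟩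
  b * (suc X * suc X ^ j)     ∎
  where
  open ≤-Reasoning
  factor : ∀ b X Y → b * Y + b * (X * Y) ≡ b * (suc X * Y)
  factor = solve-∀

-- Induction on the columns: the rows with a one in the first column have at most
-- j - 1 ones in the remaining columns.
count-sparse-rows : ∀ {m a} (row : Fin m → Fin a → Bool) (supp : Fin a → Bool) (P : Fin m → Bool) (b j : ℕ) →
  (∀ v → P v ≡ true → row v ⊆ᵇ supp) →
  (∀ v → P v ≡ true → count (row v) ≤ j) →
  (∀ Q → Q ⊆ᵇ P → SameRows row Q → count Q ≤ b) →
  count P ≤ b * suc (count supp) ^ j
count-sparse-rows {a = zero} row supp P b j _ _ classes =
  subst (count P ≤_) (sym (trans (cong (b *_) (^-zeroˡ j)) (*-identityʳ b)))
    (classes P (λ _ → id) λ _ _ _ _ ())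
count-sparse-rows {a = suc a} row supp P b j inSupp sparse classes with supp zero in supp₀
... | false = count-sparse-rows (λ v → row v ∘ suc) (supp ∘ suc) P b j
                (λ v Pv i → inSupp v Pv (suc i))
                (λ v Pv → ≤-trans (count-tail-≤ (row v)) (sparse v Pv))
                (sameRows-tail row P P b false classes (λ _ → id) column₀)
  where
  column₀ : ∀ v → P v ≡ true → row v zero ≡ false
  column₀ v Pv = ¬-not λ e → true≢false (trans (sym (inSupp v Pv zero e)) supp₀)
... | true = ≤-trans (≤-reflexive (count-split P (λ v → row v zero))) (split-bound j sparse)
  where
  tail : Fin _ → Fin a → Bool
  tail v = row v ∘ suc
  X : ℕ
  X = suc (count (supp ∘ suc))
  P₁ P₀ : Fin _ → Bool
  P₁ v = P v ∧ row v zero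
  P₀ v = P v ∧ not (row v zero)
  bound : ∀ (P′ : Fin _ → Bool) j x → P′ ⊆ᵇ P → (∀ v → P′ v ≡ true → row v zero ≡ x) →
    (∀ v → P′ v ≡ true → count (tail v) ≤ j) → count P′ ≤ b * X ^ j
  bound P′ j x P′⊆P column₀ sparse′ =
    count-sparse-rows tail (supp ∘ suc) P′ b j
      (λ v P′v i → inSupp v (P′⊆P v P′v) (suc i)) sparse′
      (sameRows-tail row P P′ b x classes P′⊆P column₀)
  bound₀ : ∀ j → (∀ v → P v ≡ true → count (row v) ≤ j) → count P₀ ≤ b * X ^ j
  bound₀ j sparse = bound P₀ j false (λ v → proj₁ ∘ ∧-true⁻) (λ v → not-true⁻ ∘ proj₂ ∘ ∧-true⁻)
    λ v e → ≤-trans (count-tail-≤ (row v)) (sparse v (proj₁ (∧-true⁻ e)))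
  split-bound : ∀ j → (∀ v → P v ≡ true → count (row v) ≤ j) → count P₁ + count P₀ ≤ b * suc X ^ j
  split-bound zero sparse =
    subst (λ c → c + count P₀ ≤ b * 1) (sym (count-none P₁ no-ones)) (bound₀ zero sparse)
    where
    no-ones : ¬ ∃ λ v → P₁ v ≡ true
    no-ones (v , e) with () ← subst (_≤ 0) (count-head-true (row v) (proj₂ (∧-true⁻ e))) (sparse v (proj₁ (∧-true⁻ e)))
  split-bound (suc j) sparse = ≤-trans (+-mono-≤ bound₁ (bound₀ (suc j) sparse)) (sum-of-powers-≤ b X j)
    where
    bound₁ : count P₁ ≤ b * X ^ j
    bound₁ = bound P₁ j true (λ v → proj₁ ∘ ∧-true⁻) (λ v → proj₂ ∘ ∧-true⁻) λ v e →
      let (Pv , row₀) = ∧-true⁻ e in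
      ≤-pred (subst (_≤ suc j) (count-head-true (row v) row₀) (sparse v Pv))

module _ (G : Graph) where
  open Graph G using (n; adj; irrefl)

  sameNeighbours⇒falseTwin : ∀ {u v} → u ≢ v → (∀ w → adj u w ≡ adj v w) → FalseTwin G v u
  sameNeighbours⇒falseTwin {u} {v} u≢v same =
    u≢v , (λ uv → true≢false (trans (sym uv) (trans (same v) (irrefl v)))) , same

  count-sameNeighbours-≤ : ∀ {k} → Rule2Irreducible G k → ∀ Q → SameRows adj Q → count Q ≤ suc k
  count-sameNeighbours-≤ {k} rule2 Q same with any? (λ v → Q v ≟ᵇ true)
  ... | no none = ≤-trans (≤-reflexive (count-none Q none)) z≤n
  ... | yes (v , Qv) = begin
    count Q                                     ≡⟨ count-split Q (λ u → does (u ≟ v)) ⟩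
    count (λ u → Q u ∧ does (u ≟ v)) + ∣ twins ∣ ≤⟨ +-mono-≤ at-most-v (rule2 v twins are-twins) ⟩
    1 + k                                       ∎
    where
    open ≤-Reasoning
    twins : Subset n
    twins = tabulate λ u → Q u ∧ not (does (u ≟ v))
    at-most-v : count (λ u → Q u ∧ does (u ≟ v)) ≤ 1
    at-most-v = ≤-trans (count-mono _ (λ u → does (u ≟ v)) λ u → proj₂ ∘ ∧-true⁻) (≤-reflexive (count-≟ v))
    are-twins : ∀ u → u ∈ twins → FalseTwin G v u
    are-twins u u∈ = let (Qu , u≠v) = ∧-true⁻ (∈-tabulate⁻ u∈) in
      sameNeighbours⇒falseTwin (λ u≡v → true≢false (trans (sym (dec-true (u ≟ v) u≡v)) (not-true⁻ u≠v)))
        (same u v Qu Qv)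

module VertexCoverPartition (G : Graph) (k : ℕ) (S : Subset (Graph.n G)) (cover : IsVertexCover G S) where
  open Graph G renaming (sym to adj-sym)

  inS : Fin n → Bool
  inS = lookup S

  lowNeighbour? : ∀ v w → Dec (Edge G v w × deg G w ≤ k)
  lowNeighbour? v w = (adj v w ≟ᵇ true) ×-dec (deg G w ≤? k)

  hasLowNeighbour : Fin n → Bool
  hasLowNeighbour v = does (any? (lowNeighbour? v))

  lowAttached highAttached : Fin n → Bool
  lowAttached  v = not (inS v) ∧ hasLowNeighbour v
  highAttached v = not (inS v) ∧ not (hasLowNeighbour v)

  n≡S+low+high : n ≡ ∣ S ∣ + (count lowAttached + count highAttached)
  n≡S+low+high = begin
    n                                                   ≡⟨ count-all n ⟨
    count {n} (λ _ → true)                              ≡⟨ count-split (λ _ → true) inS ⟩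
    count inS + count (not ∘ inS)                       ≡⟨ cong₂ _+_ (count-lookup S) (count-split (not ∘ inS) hasLowNeighbour) ⟩
    ∣ S ∣ + (count lowAttached + count highAttached)    ∎
    where open ≡-Reasoning

  outside-adj-inside : ∀ {v w} → inS v ≡ false → Edge G v w → inS w ≡ true
  outside-adj-inside {v} {w} v∉S vw with cover v w vw
  ... | inj₁ v∈S = ⊥-elim (true≢false (trans (sym ([]=⇒lookup v∈S)) v∉S))
  ... | inj₂ w∈S = []=⇒lookup w∈S

  deg-outside-≤ : ∀ {v} → inS v ≡ false → deg G v ≤ ∣ S ∣
  deg-outside-≤ {v} v∉S = ≤-trans (count-mono (adj v) inS λ w → outside-adj-inside v∉S) (≤-reflexive (count-lookup S))

  count-lowAttached-≤ : count lowAttached ≤ ∣ S ∣ * k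
  count-lowAttached-≤ = ≤-trans (count-≤-* lowAttached lowInS adj k has-low fibre)
    (*-monoˡ-≤ k (≤-trans (count-mono lowInS inS λ _ → proj₁ ∘ ∧-true⁻) (≤-reflexive (count-lookup S))))
    where
    lowInS : Fin n → Bool
    lowInS w = inS w ∧ does (deg G w ≤? k)
    has-low : ∀ v → lowAttached v ≡ true → ∃ λ w → lowInS w ≡ true × adj v w ≡ true
    has-low v e =
      let (v∉S , low) = ∧-true⁻ e
          (w , vw , degw≤k) = does-true⁻ (any? (lowNeighbour? v)) low
      in w , cong₂ _∧_ (outside-adj-inside (not-true⁻ v∉S) vw) (dec-true (deg G w ≤? k) degw≤k) , vw
    fibre : ∀ w → lowInS w ≡ true → count (λ v → adj v w) ≤ k
    fibre w e = subst (_≤ k) (count-cong (adj w) (λ v → adj v w) (adj-sym w))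
      (does-true⁻ (deg G w ≤? k) (proj₂ (∧-true⁻ e)))

  highAttached-in-I : ∣ S ∣ ≤ k → ∀ {v} → highAttached v ≡ true → InI G k v
  highAttached-in-I ∣S∣≤k {v} e = not-high , neighbours-high
    where
    v∉S : inS v ≡ false
    v∉S = not-true⁻ (proj₁ (∧-true⁻ e))
    not-high : ¬ InH G k v
    not-high high = <-irrefl refl (≤-trans high (≤-trans (deg-outside-≤ v∉S) ∣S∣≤k))
    neighbours-high : ∀ w → Edge G v w → InH G k w
    neighbours-high w vw = ≰⇒> λ degw≤k →
      does-false⁻ (any? (lowNeighbour? v)) (not-true⁻ (proj₂ (∧-true⁻ e))) (w , vw , degw≤k)

  count-highAttached-≤ : ∀ {j} → ∣ S ∣ ≤ k → Rule1Irreducible G k (suc j) → Rule2Irreducible G k →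
    count highAttached ≤ suc k ^ suc j
  count-highAttached-≤ {j} ∣S∣≤k rule1 rule2 = begin
    count highAttached          ≤⟨ count-sparse-rows adj inS highAttached (suc k) j support sparse classes ⟩
    suc k * suc (count inS) ^ j ≡⟨ cong (λ c → suc k * suc c ^ j) (count-lookup S) ⟩
    suc k * suc ∣ S ∣ ^ j       ≤⟨ *-monoʳ-≤ (suc k) (^-monoˡ-≤ j (s≤s ∣S∣≤k)) ⟩
    suc k * suc k ^ j           ∎
    where
    open ≤-Reasoning
    support : ∀ v → highAttached v ≡ true → adj v ⊆ᵇ inS
    support v e w = outside-adj-inside (not-true⁻ (proj₁ (∧-true⁻ e)))
    sparse : ∀ v → highAttached v ≡ true → count (adj v) ≤ j
    sparse v e = ≤-pred (rule1 v (highAttached-in-I ∣S∣≤k e))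
    classes : ∀ Q → Q ⊆ᵇ highAttached → SameRows adj Q → count Q ≤ suc k
    classes Q _ = count-sameNeighbours-≤ G rule2 Q

suc-^-≤ : ∀ {k} → 1 ≤ k → ∀ d → suc k ^ d ≤ 2 ^ d * k ^ d
suc-^-≤ k≥1 zero    = ≤-refl
suc-^-≤ {k} k≥1 (suc d) = ≤-trans (*-mono-≤ (+-monoˡ-≤ k k≥1) (suc-^-≤ k≥1 d)) (≤-reflexive (rearrange k (2 ^ d) (k ^ d)))
  where
  rearrange : ∀ k a b → (k + k) * (a * b) ≡ (2 * a) * (k * b)
  rearrange = solve-∀

size-bound : ∀ {k d n a b c} → 1 ≤ k → n ≡ a + (b + c) → a ≤ k → b ≤ k * k → c ≤ suc k ^ d →
  n ≤ (2 ^ d + 2) * (k ^ d + k ^ 2)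
size-bound {k} {d} {a = a} {b} {c} k≥1 refl a≤k b≤k² c≤ = begin
  a + (b + c)
    ≤⟨ +-mono-≤ (≤-trans a≤k (m≤m*n k k ⦃ >-nonZero k≥1 ⦄)) (+-mono-≤ b≤k² (≤-trans c≤ (suc-^-≤ k≥1 d))) ⟩
  k * k + (k * k + 2 ^ d * k ^ d)
    ≤⟨ m≤m+n _ _ ⟩
  k * k + (k * k + 2 ^ d * k ^ d) + (2 ^ d * k ^ 2 + (k ^ d + k ^ d))
    ≡⟨ expand k (2 ^ d) (k ^ d) ⟨
  (2 ^ d + 2) * (k ^ d + k ^ 2)
    ∎
  where
  open ≤-Reasoning
  expand : ∀ k a K → (a + 2) * (K + k * (k * 1)) ≡ k * k + (k * k + a * K) + (a * (k * (k * 1)) + (K + K))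
  expand = solve-∀

lemma4p3 : (d : ℕ) → 1 ≤ d → Σ ℕ λ C → (k : ℕ) → 1 ≤ k → (G : Graph) → HasCVCOfSize≤ G k → Rule1Irreducible G k d → Rule2Irreducible G k → Graph.n G ≤ C * (k ^ d + k ^ 2)
lemma4p3 (suc j) _ = 2 ^ suc j + 2 , λ where
  k k≥1 G (S , (cover , _) , ∣S∣≤k) rule1 rule2 →
    let open VertexCoverPartition G k S cover in
    size-bound {d = suc j} k≥1 n≡S+low+high ∣S∣≤k
      (≤-trans count-lowAttached-≤ (*-monoˡ-≤ k ∣S∣≤k))
      (count-highAttached-≤ {j} ∣S∣≤k rule1 rule2)
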